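{- Let $r\ge 3$ and $1\le t\le r-2$ be integers, and let $n_1\ge\dots\ge n_r\ge 2$. If $\mathcal{F}\subseteq X_1\times\dots\times X_r$ is coordinate-wise shifted, $t$-intersecting and satisfies $|\bigcap\mathcal{F}|<t$, then the family of projections $\mathcal{P}(\mathcal{F})\subseteq 2^{[r]}$ is $t$-intersecting and satisfies $|\bigcap\mathcal{P}(\mathcal{F})|<t$.
   Context: $X_\ell=\{1,\dots,n_\ell\}$. For $A\in X_1\times\dots\times X_r$, $A[\ell]$ is its $\ell$-th coordinate; for $A,B$ in the product, $A\cap B=\{\ell: A[\ell]=B[\ell]\}$. A family $\mathcal{F}$ of sequences is $t$-intersecting if $|A\cap B|\ge t$ for all $A,B\in\mathcal{F}$, and $\bigcap\mathcal{F}$ is the set of $\ell\in[r]$ such that all members of $\mathcal{F}$ have the same $\ell$-th coordinate. A family $\mathcal{H}\subseteq 2^{[r]}$ is $t$-intersecting if $|A\cap B|\ge t$ for all $A,B\in\mathcal{H}$, and $\bigcap\mathcal{H}$ is the intersection of all its members. The projection of $F$ is $\mathcal{P}(F)=\{\ell: F[\ell]=1\}$, and $\mathcal{P}(\mathcal{F})=\{\mathcal{P}(F):F\in\mathcal{F}\}$. Shifts: for $\ell\in[r]$ and $1<j\le n_\ell$, given $\mathcal{F}$, for $A\in\mathcal{F}$ let $A'$ be $A$ with its $\ell$-th coordinate replaced by $1$; set $S^{(\ell)}_j(A)=A'$ if $A[\ell]=j$ and $A'\notin\mathcal{F}$, and $S^{(\ell)}_j(A)=A$ otherwise; $S^{(\ell)}_j(\mathcal{F})=\{S^{(\ell)}_j(A):A\in\mathcal{F}\}$.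 $\mathcal{F}$ is $\ell$-shifted if $S^{(\ell)}_j(\mathcal{F})=\mathcal{F}$ for all $1<j\le n_\ell$, and coordinate-wise shifted if it is $\ell$-shifted for every $\ell\in[r]$. -}

module Defs where

open import Data.Nat using (ℕ; zero; suc; _≤_)
open import Data.Fin using (Fin; zero; suc)
open import Data.Fin.Properties using (_≟_; all?)
open import Data.Fin.Subset using (Subset; ⊤; _∩_; inside; outside)
open import Data.Vec using (tabulate)
open import Data.List using (List; []; _∷_; map; foldr)
open import Data.List.Membership.Propositional using (_∈_)
open import Data.List.Relation.Unary.All as All using (All)
open import Data.Bool using (Bool; true; false)
open import Data.Product using (Σ; _×_; _,_; ∃)
open import Data.Sum using (_⊎_)
open import Relation.Nullary using (¬_; does)
open import Relation.Binary.PropositionalEquality using (_≡_; _≢_)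
open import Function.Bundles using (_⇔_)

-- Sizes n_ℓ ≥ 1 are encoded as n ℓ = suc (m ℓ); X_ℓ = Fin (n ℓ),
-- and the paper's element "1" of X_ℓ is  zero : Fin (n ℓ).
-- A sequence A ∈ X_1 × ... × X_r is a dependent function.
Seq : (r : ℕ) → (Fin r → ℕ) → Set
Seq r n = (ℓ : Fin r) → Fin (n ℓ)

Family : (r : ℕ) → (Fin r → ℕ) → Set
Family r n = List (Seq r n)

module _ {r : ℕ} {n : Fin r → ℕ} where

  agree : Seq r n → Seq r n → Subset r
  agree A B = tabulate (λ ℓ → does (A ℓ ≟ B ℓ))

  interSize : Seq r n → Seq r n → ℕ
  interSize A B = Data.Fin.Subset.∣ agree A B ∣

  IsTIntersecting : ℕ → Family r n → Set
  IsTIntersecting t F = ∀ {A B} → A ∈ F → B ∈ F → t ≤ interSize A B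

  -- ⋂F = { ℓ : all members of F have the same ℓ-th coordinate }
  --    = the intersection over all A, B ∈ F of (A ∩ B)
  bigCap : Family r n → Subset r
  bigCap F = foldr (λ A S → foldr (λ B S' → agree A B ∩ S') S F) ⊤ F

-- The shifted family, given as a membership predicate (it is a set of sequences).
-- S^{(ℓ)}_j(A) = A' (A with ℓ-th coordinate set to 1) if A[ℓ] = j and A' ∉ F, else A.
module _ {r : ℕ} {m : Fin r → ℕ} where

  private
    n : Fin r → ℕ
    n ℓ = suc (m ℓ)

  setCoord : (ℓ : Fin r) → Fin (n ℓ) → Seq r n → Seq r n
  setCoord ℓ x A ℓ' with ℓ' ≟ ℓ
  ... | Relation.Nullary.yes Relation.Binary.PropositionalEquality.refl = x
  ... | Relation.Nullary.no _ = A ℓ'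

  toOne : (ℓ : Fin r) → Seq r n → Seq r n
  toOne ℓ A = setCoord ℓ zero A

  _≈S_ : Seq r n → Seq r n → Set
  A ≈S B = ∀ ℓ → A ℓ ≡ B ℓ

  _∈F_ : Seq r n → Family r n → Set
  A ∈F F = Σ (Seq r n) λ B → B ∈ F × B ≈S A

  ShiftElem : (ℓ : Fin r) → Fin (n ℓ) → Family r n → Seq r n → Seq r n → Set
  ShiftElem ℓ j F A B =
    (A ℓ ≡ j × ¬ (toOne ℓ A ∈F F) × B ≈S toOne ℓ A)
    ⊎ (¬ (A ℓ ≡ j × ¬ (toOne ℓ A ∈F F)) × B ≈S A)

  _∈Shift[_,_]_ : Seq r n → (ℓ : Fin r) → Fin (n ℓ) → Family r n → Set
  B ∈Shift[ ℓ , j ] F = Σ (Seq r n) λ A → A ∈ F × ShiftElem ℓ j F A B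

  ShiftFixed : (ℓ : Fin r) → Fin (n ℓ) → Family r n → Set
  ShiftFixed ℓ j F = ∀ B → (B ∈Shift[ ℓ , j ] F) ⇔ (B ∈F F)

  -- ℓ-shifted: fixed by all S^{(ℓ)}_j with 1 < j ≤ n_ℓ (j ranges over suc k)
  IsShiftedAt : Fin r → Family r n → Set
  IsShiftedAt ℓ F = (k : Fin (m ℓ)) → ShiftFixed ℓ (suc k) F

  IsCoordShifted : Family r n → Set
  IsCoordShifted F = (ℓ : Fin r) → IsShiftedAt ℓ F

  proj : Seq r n → Subset r
  proj A = tabulate (λ ℓ → does (A ℓ ≟ zero))

  projFam : Family r n → List (Subset r)
  projFam F = map proj F

module _ {r : ℕ} where

  IsTIntersectingSets : ℕ → List (Subset r) → Set
  IsTIntersectingSets t H = ∀ {A B} → A ∈ H → B ∈ H → t ≤ Data.Fin.Subset.∣ A ∩ B ∣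

  -- ⋂H (intersection of all members; [r] for the empty family)
  bigCapSets : List (Subset r) → Subset r
  bigCapSets H = foldr _∩_ ⊤ H

-- Shiftedness makes F closed under resetting any set of coordinates to 1: each single reset is
-- either a shift S^{(ℓ)}_j or lands on a sequence already in F.  For A, B ∈ F, resetting to 1
-- the coordinates on which A and B agree gives C ∈ F with C ∩ B = P(A) ∩ P(B), whence
-- |P(A) ∩ P(B)| ≥ t.  Every coordinate on which all members of F are 1 lies in ⋂F, so
-- |⋂P(F)| ≤ |⋂F| < t.
{-# OPTIONS --safe #-}
module Submission where

open import Defs
open import Data.Bool using (true; false; if_then_else_)
open import Data.Empty using (⊥-elim)
open import Data.Fin using (Fin; toℕ; zero; suc)
open import Data.Fin.Properties using (_≟_; all?)
open import Data.Fin.Subset using (Subset; ⊤; _∩_; _∈_; _⊆_; ⋂; ∣_∣)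
open import Data.Fin.Subset.Properties using (p⊆q⇒∣p∣≤∣q∣; x∈p∩q⁺; x∈p∩q⁻; ∈⊤)
open import Data.List using (List; []; _∷_; foldr; allFin)
open import Data.List.Membership.Propositional using (find; lose) renaming (_∈_ to _∈ˡ_)
open import Data.List.Membership.Propositional.Properties using (∈-map⁻; ∈-allFin)
open import Data.List.Relation.Unary.All as All using (All; []; _∷_)
open import Data.List.Relation.Unary.All.Properties using (map⁻)
open import Data.List.Relation.Unary.Any using (here; there; any?)
open import Data.Nat using (ℕ; suc; _≤_; _<_; _∸_)
open import Data.Nat.Properties using (≤-trans; ≤-<-trans)
open import Data.Product using (_×_; _,_)
open import Data.Sum using (_⊎_; inj₁; inj₂)
open import Data.Vec using (tabulate)
open import Data.Vec.Properties using (lookup∘tabulate; []=⇒lookup; lookup⇒[]=)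
open import Function using (_∘_)
open import Function.Bundles using (Equivalence)
open import Relation.Nullary using (¬_; Dec; yes; no; does)
open import Relation.Nullary.Decidable using (dec-true; map′)
open import Relation.Binary.PropositionalEquality using (_≡_; refl; sym; trans)

module _ {n : ℕ} {P : Fin n → Set} (P? : ∀ i → Dec (P i)) where

  ∈-tabulate-does⁺ : ∀ {i} → P i → i ∈ tabulate (does ∘ P?)
  ∈-tabulate-does⁺ {i} p = lookup⇒[]= i _ (trans (lookup∘tabulate (does ∘ P?) i) (dec-true (P? i) p))

  ∈-tabulate-does⁻ : ∀ {i} → i ∈ tabulate (does ∘ P?) → P i
  ∈-tabulate-does⁻ {i} i∈ with P? i | trans (sym (lookup∘tabulate (does ∘ P?) i)) ([]=⇒lookup i∈)
  ... | yes p | _ = p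
  ... | no _  | ()

∈-⋂⁻ : ∀ {n} {i : Fin n} (ps : List (Subset n)) → i ∈ ⋂ ps → All (i ∈_) ps
∈-⋂⁻ []       _  = []
∈-⋂⁻ (p ∷ ps) i∈ = let i∈p , i∈ps = x∈p∩q⁻ p (⋂ ps) i∈ in i∈p ∷ ∈-⋂⁻ ps i∈ps

module _ {r : ℕ} {m : Fin r → ℕ} where

  private
    Sq : Set
    Sq = Seq r (λ ℓ → suc (m ℓ))

    Fam : Set
    Fam = Family r (λ ℓ → suc (m ℓ))

  ≈S-sym : {A B : Sq} → A ≈S B → B ≈S A
  ≈S-sym A≈B ℓ = sym (A≈B ℓ)

  ∈F-resp-≈S : {F : Fam} {A C : Sq} → A ∈F F → A ≈S C → C ∈F F
  ∈F-resp-≈S (B , B∈ , B≈A) A≈C = B , B∈ , λ ℓ → trans (B≈A ℓ) (A≈C ℓ)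

  ∈F? : (C : Sq) (F : Fam) → Dec (C ∈F F)
  ∈F? C F = map′ find (λ (B , B∈ , B≈C) → lose B∈ B≈C) (any? (λ B → all? (λ ℓ → B ℓ ≟ C ℓ)) F)

  setCoord-id : ∀ ℓ {x} (A : Sq) → x ≡ A ℓ → setCoord ℓ x A ≈S A
  setCoord-id ℓ A x≡Aℓ ℓ′ with ℓ′ ≟ ℓ
  ... | yes refl = x≡Aℓ
  ... | no _     = refl

  setCoord-cong : ∀ ℓ x {A B : Sq} → A ≈S B → setCoord ℓ x A ≈S setCoord ℓ x B
  setCoord-cong ℓ x A≈B ℓ′ with ℓ′ ≟ ℓ
  ... | yes refl = refl
  ... | no _     = A≈B ℓ′

  _⊑_ : Sq → Sq → Set
  C ⊑ A = ∀ ℓ → C ℓ ≡ A ℓ ⊎ C ℓ ≡ zero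

  module _ {F : Fam} (shifted : IsCoordShifted F) where

    toOne-∈F : ∀ ℓ {B} → B ∈ˡ F → toOne ℓ B ∈F F
    toOne-∈F ℓ {B} B∈ with B ℓ in Bℓ≡
    ... | zero  = B , B∈ , ≈S-sym (setCoord-id ℓ B (sym Bℓ≡))
    ... | suc k with ∈F? (toOne ℓ B) F
    ...   | yes B′∈ = B′∈
    ...   | no  B′∉ = Equivalence.to (shifted ℓ k (toOne ℓ B)) (B , B∈ , inj₁ (Bℓ≡ , B′∉ , λ _ → refl))

    setCoord-∈F : ∀ ℓ {x} {A : Sq} → A ∈F F → x ≡ A ℓ ⊎ x ≡ zero → setCoord ℓ x A ∈F F
    setCoord-∈F ℓ {A = A} A∈ (inj₁ x≡Aℓ) = ∈F-resp-≈S A∈ (≈S-sym (setCoord-id ℓ A x≡Aℓ))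
    setCoord-∈F ℓ (B , B∈ , B≈A) (inj₂ refl) = ∈F-resp-≈S (toOne-∈F ℓ B∈) (setCoord-cong ℓ zero B≈A)

    ⊑-∈F-outside : (L : List (Fin r)) {A C : Sq} → A ∈F F → C ⊑ A →
                   (∀ ℓ → ¬ ℓ ∈ˡ L → C ℓ ≡ A ℓ) → C ∈F F
    ⊑-∈F-outside []       A∈ _   C≡A = ∈F-resp-≈S A∈ (λ ℓ → sym (C≡A ℓ λ ()))
    ⊑-∈F-outside (ℓ₀ ∷ L) {A} {C} A∈ C⊑A C≡A =
      ⊑-∈F-outside L (setCoord-∈F ℓ₀ A∈ (C⊑A ℓ₀)) C⊑A′ C≡A′
      where
      C⊑A′ : C ⊑ setCoord ℓ₀ (C ℓ₀) A
      C⊑A′ ℓ with ℓ ≟ ℓ₀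
      ... | yes refl = inj₁ refl
      ... | no _     = C⊑A ℓ

      C≡A′ : ∀ ℓ → ¬ ℓ ∈ˡ L → C ℓ ≡ setCoord ℓ₀ (C ℓ₀) A ℓ
      C≡A′ ℓ ℓ∉L with ℓ ≟ ℓ₀
      ... | yes refl = refl
      ... | no ℓ≢ℓ₀ = C≡A ℓ λ { (here ℓ≡ℓ₀) → ℓ≢ℓ₀ ℓ≡ℓ₀ ; (there ℓ∈L) → ℓ∉L ℓ∈L }

    ⊑-∈F : {A C : Sq} → A ∈F F → C ⊑ A → C ∈F F
    ⊑-∈F A∈ C⊑A = ⊑-∈F-outside (allFin r) A∈ C⊑A (λ ℓ ℓ∉ → ⊥-elim (ℓ∉ (∈-allFin ℓ)))

  resetAgreements : Sq → Sq → Sq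
  resetAgreements A B ℓ = if does (A ℓ ≟ B ℓ) then zero else A ℓ

  resetAgreements-⊑ : (A B : Sq) → resetAgreements A B ⊑ A
  resetAgreements-⊑ A B ℓ with does (A ℓ ≟ B ℓ)
  ... | true  = inj₂ refl
  ... | false = inj₁ refl

  resetAgreements-≡ : (A B : Sq) {ℓ : Fin r} → resetAgreements A B ℓ ≡ B ℓ → A ℓ ≡ zero × B ℓ ≡ zero
  resetAgreements-≡ A B {ℓ} e with A ℓ ≟ B ℓ
  ... | yes Aℓ≡Bℓ = trans Aℓ≡Bℓ (sym e) , sym e
  ... | no  Aℓ≢Bℓ = ⊥-elim (Aℓ≢Bℓ e)

  agree-⊆-proj∩proj : (A B : Sq) {C : Sq} → C ≈S resetAgreements A B → agree C B ⊆ proj A ∩ proj B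
  agree-⊆-proj∩proj A B {C} C≈ {ℓ} ℓ∈
    with resetAgreements-≡ A B (trans (sym (C≈ ℓ)) (∈-tabulate-does⁻ (λ ℓ → C ℓ ≟ B ℓ) ℓ∈))
  ... | Aℓ≡0 , Bℓ≡0 =
    x∈p∩q⁺ (∈-tabulate-does⁺ (λ ℓ → A ℓ ≟ zero) Aℓ≡0 , ∈-tabulate-does⁺ (λ ℓ → B ℓ ≟ zero) Bℓ≡0)

  projFam-isTIntersecting : ∀ {t} {F : Fam} → IsCoordShifted F → IsTIntersecting t F →
                            IsTIntersectingSets t (projFam F)
  projFam-isTIntersecting shifted tInt P∈ Q∈ with ∈-map⁻ proj P∈ | ∈-map⁻ proj Q∈
  ... | A , A∈ , refl | B , B∈ , refl
    with ⊑-∈F shifted (A , A∈ , λ _ → refl) (resetAgreements-⊑ A B)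
  ... | C , C∈ , C≈ = ≤-trans (tInt C∈ B∈) (p⊆q⇒∣p∣≤∣q∣ (agree-⊆-proj∩proj A B C≈))

  module _ {ℓ : Fin r} {x : Fin (suc (m ℓ))} where

    ∈-foldr-agree : (A : Sq) (L : List Sq) {S : Subset r} → A ℓ ≡ x → All (λ B → B ℓ ≡ x) L →
                    ℓ ∈ S → ℓ ∈ foldr (λ B S′ → agree A B ∩ S′) S L
    ∈-foldr-agree A []      _    _            ℓ∈S = ℓ∈S
    ∈-foldr-agree A (B ∷ L) Aℓ≡x (Bℓ≡x ∷ Lℓ≡x) ℓ∈S =
      x∈p∩q⁺ (∈-tabulate-does⁺ (λ ℓ → A ℓ ≟ B ℓ) (trans Aℓ≡x (sym Bℓ≡x)) , ∈-foldr-agree A L Aℓ≡x Lℓ≡x ℓ∈S)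

    ∈-bigCap : {F : Fam} → All (λ A → A ℓ ≡ x) F → ℓ ∈ bigCap F
    ∈-bigCap {F} Fℓ≡x = outer F Fℓ≡x
      where
      outer : (L : List Sq) → All (λ A → A ℓ ≡ x) L →
              ℓ ∈ foldr (λ A S → foldr (λ B S′ → agree A B ∩ S′) S F) ⊤ L
      outer []      []            = ∈⊤
      outer (A ∷ L) (Aℓ≡x ∷ Lℓ≡x) = ∈-foldr-agree A F Aℓ≡x Fℓ≡x (outer L Lℓ≡x)

  bigCapSets-projFam-⊆-bigCap : (F : Fam) → bigCapSets (projFam F) ⊆ bigCap F
  bigCapSets-projFam-⊆-bigCap F ℓ∈ =
    ∈-bigCap (All.map (λ {A} → ∈-tabulate-does⁻ (λ ℓ → A ℓ ≟ zero)) (map⁻ (∈-⋂⁻ (projFam F) ℓ∈)))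

lemma2p1 : (r t : ℕ) → 3 ≤ r → 1 ≤ t → t ≤ r ∸ 2 →
    (m : Fin r → ℕ) →
    (∀ (i j : Fin r) → toℕ i ≤ toℕ j → suc (m j) ≤ suc (m i)) →
    (∀ (ℓ : Fin r) → 2 ≤ suc (m ℓ)) →
    (F : Family r (λ ℓ → suc (m ℓ))) →
    IsCoordShifted F → IsTIntersecting t F → ∣ bigCap F ∣ < t →
    IsTIntersectingSets t (projFam F) × ∣ bigCapSets (projFam F) ∣ < t
lemma2p1 _ _ _ _ _ _ _ _ F shifted tInt smallCap =
  projFam-isTIntersecting shifted tInt ,
  ≤-<-trans (p⊆q⇒∣p∣≤∣q∣ (bigCapSets-projFam-⊆-bigCap F)) smallCap
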